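{- Let $K$ be a number field, $V_K^f$ the set of its normalized non-archimedean valuations, and $D=\bigoplus_{v\in V_K^f}\mathbb{Z}$ the set of finitely supported functions $V_K^f\to\mathbb{Z}$. For every formula $\Phi(x_1,\dots,x_n)$ of the language $\{+,\wedge,\vee,0\}$ and all $f_1,\dots,f_n\in D$, the set $\{v\in V_K^f: (\mathbb{Z},+,\min,\max,0)\models\Phi(f_1(v),\dots,f_n(v))\}$ is either finite or cofinite in $V_K^f$. -}

module Defs where

open import Data.Nat using (ℕ; suc)
open import Data.Fin using (Fin; zero; suc)
open import Data.Integer using (ℤ; _⊓_; _⊔_) renaming (_+_ to _+ℤ_; 0ℤ to 0ℤ)
open import Data.List using (List)
open import Data.List.Membership.Propositional using (_∈_; _∉_)
open import Data.Product using (Σ; ∃; _×_)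
open import Data.Sum using (_⊎_)
open import Data.Empty using (⊥)
open import Data.Unit using (⊤)
open import Relation.Nullary using (¬_)
open import Relation.Binary.PropositionalEquality using (_≡_)

data Term (n : ℕ) : Set where
  var  : Fin n → Term n
  zer  : Term n
  _⊕_  : Term n → Term n → Term n
  _⋀_  : Term n → Term n → Term n
  _⋁_  : Term n → Term n → Term n

data Formula (n : ℕ) : Set where
  _≐_  : Term n → Term n → Formula n
  ff   : Formula n
  tt   : Formula n
  ¬'_  : Formula n → Formula n
  _∧'_ : Formula n → Formula n → Formula n
  _∨'_ : Formula n → Formula n → Formula n
  _⇒'_ : Formula n → Formula n → Formula n
  ∀'   : Formula (suc n) → Formula n
  ∃'   : Formula (suc n) → Formula n

_∷ₐ_ : {n : ℕ} → ℤ → (Fin n → ℤ) → Fin (suc n) → ℤ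
(a ∷ₐ ρ) zero    = a
(a ∷ₐ ρ) (suc i) = ρ i

eval : {n : ℕ} → Term n → (Fin n → ℤ) → ℤ
eval (var i) ρ = ρ i
eval zer ρ = 0ℤ
eval (s ⊕ t) ρ = eval s ρ +ℤ eval t ρ
eval (s ⋀ t) ρ = eval s ρ ⊓ eval t ρ
eval (s ⋁ t) ρ = eval s ρ ⊔ eval t ρ

Sat : {n : ℕ} → Formula n → (Fin n → ℤ) → Set
Sat (s ≐ t) ρ = eval s ρ ≡ eval t ρ
Sat ff ρ = ⊥
Sat tt ρ = ⊤
Sat (¬' φ) ρ = ¬ Sat φ ρ
Sat (φ ∧' ψ) ρ = Sat φ ρ × Sat ψ ρ
Sat (φ ∨' ψ) ρ = Sat φ ρ ⊎ Sat ψ ρ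
Sat (φ ⇒' ψ) ρ = Sat φ ρ → Sat ψ ρ
Sat (∀' φ) ρ = (a : ℤ) → Sat φ (a ∷ₐ ρ)
Sat (∃' φ) ρ = Σ ℤ λ a → Sat φ (a ∷ₐ ρ)

FinSupp : {V : Set} → (V → ℤ) → Set
FinSupp {V} f = Σ (List V) λ L → (v : V) → v ∉ L → f v ≡ 0ℤ

IsFinite : {V : Set} → (V → Set) → Set
IsFinite {V} P = Σ (List V) λ L → (v : V) → P v → v ∈ L

IsCofinite : {V : Set} → (V → Set) → Set
IsCofinite {V} P = Σ (List V) λ L → (v : V) → ¬ P v → v ∈ L

-- Off the finite union S of the supports of the fᵢ, every valuation gives Φ the same arguments
-- (0, …, 0); so the set contains or avoids the complement of S according as Φ(0, …, 0) holds.
-- Constructively that needs a decision procedure for (ℤ, +, min, max, 0). Terms built with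
-- min and max are piecewise linear, so atomic formulas become quantifier-free Presburger
-- formulas, and each quantifier is eliminated by Cooper's method: after scaling the bound
-- variable to coefficient ±1, ∃y is equivalent to a finite disjunction over the values of y
-- near −∞ (taken modulo the period of the divisibility atoms) and just above its lower bounds.

module Submission where

open import Defs
open import Level using (0ℓ)
open import Function using (_∘_; _⇔_; mk⇔; Equivalence)
open import Function.Properties.Equivalence using (⇔-setoid)
open import Relation.Binary.Bundles using (Setoid)
open import Data.Nat as ℕ using (ℕ; zero; suc; s≤s; _/_)
import Data.Nat.Properties as ℕₚ
import Data.Nat.Divisibility as ℕ∣
open ℕ∣ using () renaming (_∣_ to _∣ℕ_)
open import Data.Nat.DivMod using (m/n*n≡m)
open import Data.Fin using (Fin; zero; suc)
open import Data.Integer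
  using (ℤ; +_; -[1+_]; +[1+_]; 0ℤ; 1ℤ; -1ℤ; _+_; _*_; -_; _-_; _≤_; _<_; +≤+; +<+; -≤+;
         _⊓_; _⊔_; ∣_∣; pred; positive; _%ℕ_; _/ℕ_)
open import Data.Integer.Properties
open import Data.Integer.DivMod using (a≡a%ℕn+[a/ℕn]*n; n%ℕd<d)
open import Data.Integer.Divisibility.Signed
  using (_∣_; divides; _∣?_; ∣-refl; ∣-trans; ∣m∣n⇒∣m+n; ∣m+n∣n⇒∣m; ∣n⇒∣m*n; ∣m⇒∣m*n; ∣m⇒∣-m;
         *-monoʳ-∣; *-cancelˡ-∣)
open import Data.Integer.Tactic.RingSolver using (solve-∀)
open import Data.Vec using (Vec; []; _∷_; map; zipWith; replicate)
open import Data.List using (List; []; _∷_; _++_; downFrom; concat; tabulate)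
open import Data.List.Relation.Unary.Any using (Any; here; there)
open import Data.List.Membership.Propositional using (_∈_; _∉_; find; lose)
open import Data.List.Membership.Propositional.Properties
  using (∈-++⁺ˡ; ∈-++⁺ʳ; ∈-downFrom⁺; ∈-downFrom⁻; ∈-concat⁺′; ∈-tabulate⁺)
import Data.List.Membership.DecPropositional as DecMembership
open import Data.Product using (Σ; ∃; ∃-syntax; _×_; _,_; proj₁; proj₂)
open import Data.Product.Function.NonDependent.Propositional using (_×-⇔_)
open import Data.Sum as Sum using (_⊎_; inj₁; inj₂)
open import Data.Sum.Function.Propositional using (_⊎-⇔_)
open import Data.Empty using (⊥; ⊥-elim)
open import Data.Unit using (⊤; tt)
open import Relation.Nullary using (¬_; Dec; yes; no; contradiction)
open import Relation.Nullary.Decidable using (_×-dec_; _⊎-dec_; ¬?; decidable-stable)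
open import Relation.Binary.Definitions using (DecidableEquality)
open import Relation.Binary.PropositionalEquality
  using (_≡_; refl; sym; trans; cong; cong₂; subst; subst₂; _≗_; module ≡-Reasoning)

open Equivalence using (to; from)
open Setoid (⇔-setoid 0ℓ) using () renaming (refl to ⇔-refl; sym to ⇔-sym; trans to ⇔-trans)

private variable
  n : ℕ
  A B : Set

subst-⇔ : (P : ℤ → Set) {i j : ℤ} → i ≡ j → P i ⇔ P j
subst-⇔ P refl = ⇔-refl

subst₂-⇔ : (P : ℤ → ℤ → Set) {i i′ j j′ : ℤ} → i ≡ i′ → j ≡ j′ → P i j ⇔ P i′ j′
subst₂-⇔ P refl refl = ⇔-refl

¬-⇔ : A ⇔ B → (¬ A) ⇔ (¬ B)
¬-⇔ A⇔B = mk⇔ (λ ¬a → ¬a ∘ from A⇔B) (λ ¬b → ¬b ∘ to A⇔B)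

→-⇔ : ∀ {A′ B′ : Set} → A ⇔ A′ → B ⇔ B′ → (A → B) ⇔ (A′ → B′)
→-⇔ A⇔A′ B⇔B′ = mk⇔ (λ f → to B⇔B′ ∘ f ∘ from A⇔A′) (λ f → from B⇔B′ ∘ f ∘ to A⇔A′)

Σ-⇔ : ∀ {P Q : ℤ → Set} → (∀ a → P a ⇔ Q a) → ∃ P ⇔ ∃ Q
Σ-⇔ P⇔Q = mk⇔ (λ (a , p) → a , to (P⇔Q a) p) (λ (a , q) → a , from (P⇔Q a) q)

Π⇔¬Σ : ∀ {P N : ℤ → Set} → (∀ a → P a ⇔ (¬ N a)) → (∀ a → P a) ⇔ (¬ ∃ N)
Π⇔¬Σ P⇔¬N = mk⇔ (λ p (a , na) → to (P⇔¬N a) (p a) na) (λ ¬∃N a → from (P⇔¬N a) (λ na → ¬∃N (a , na)))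

¬¬⇔ : Dec A → (¬ ¬ A) ⇔ A
¬¬⇔ a? = mk⇔ (decidable-stable a?) (λ a ¬a → ¬a a)

¬⊎¬⇔¬× : Dec A → (¬ A ⊎ ¬ B) ⇔ (¬ (A × B))
¬⊎¬⇔¬× a? = mk⇔ (λ { (inj₁ ¬a) (a , _) → ¬a a ; (inj₂ ¬b) (_ , b) → ¬b b }) (from′ a?)
  where
  from′ : Dec A → ¬ (A × B) → ¬ A ⊎ ¬ B
  from′ (yes a) ¬ab = inj₂ (λ b → ¬ab (a , b))
  from′ (no ¬a) _   = inj₁ ¬a

¬×¬⇔¬⊎ : (¬ A × ¬ B) ⇔ (¬ (A ⊎ B))
¬×¬⇔¬⊎ = mk⇔ (λ { (¬a , ¬b) → Sum.[ ¬a , ¬b ] }) (λ ¬ab → ¬ab ∘ inj₁ , ¬ab ∘ inj₂)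

¬⊎⇔→ : Dec A → (¬ A ⊎ B) ⇔ (A → B)
¬⊎⇔→ a? = mk⇔ (λ { (inj₁ ¬a) a → contradiction a ¬a ; (inj₂ b) _ → b }) (from′ a?)
  where
  from′ : Dec A → (A → B) → ¬ A ⊎ B
  from′ (yes a) f = inj₂ (f a)
  from′ (no ¬a) _ = inj₁ ¬a

0<-⇔< : ∀ {i j} → 0ℤ < j - i ⇔ i < j
0<-⇔< {i} {j} = mk⇔
  (λ 0<j-i → subst₂ _<_ (+-identityˡ i) (j-i+i≡j j i) (+-monoˡ-< i 0<j-i))
  (λ i<j → subst (_< j - i) (+-inverseʳ i) (+-monoˡ-< (- i) i<j))
  where
  j-i+i≡j : ∀ j i → j - i + i ≡ j
  j-i+i≡j = solve-∀

¬0<⇔0<1- : ∀ {i} → (¬ 0ℤ < i) ⇔ 0ℤ < 1ℤ - i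
¬0<⇔0<1- {i} = mk⇔
  (λ i≯0 → from (0<-⇔< {i} {1ℤ}) (i≤pred[j]⇒i<j (≮⇒≥ i≯0)))
  (λ 0<1-i → ≤⇒≯ (i<j⇒i≤pred[j] (to (0<-⇔< {i} {1ℤ}) 0<1-i)))

≡⇔≮×≯ : ∀ {i j} → i ≡ j ⇔ (¬ i < j × ¬ j < i)
≡⇔≮×≯ = mk⇔
  (λ { refl → <-irrefl refl , <-irrefl refl })
  (λ { (i≮j , j≮i) → ≤-antisym (≮⇒≥ j≮i) (≮⇒≥ i≮j) })

0<⇒≡+[1+] : ∀ {i} → 0ℤ < i → ∃[ k ] i ≡ + suc k
0<⇒≡+[1+] {+[1+ k ]} _ = k , refl
0<⇒≡+[1+] {+ zero} (+<+ ())

*-pos-<⇔ : ∀ {M i j} → 0ℤ < M → i < j ⇔ M * i < M * j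
*-pos-<⇔ {M@(+ _)} 0<M = mk⇔
  (*-monoˡ-<-pos M {{positive 0<M}})
  (*-cancelˡ-<-nonNeg M)

*-∣⇔ : ∀ k {m i} → (m ∣ i) ⇔ (+ suc k * m ∣ + suc k * i)
*-∣⇔ k = mk⇔ (*-monoʳ-∣ (+ suc k)) (*-cancelˡ-∣ (+ suc k))

∣⇔∣+ : ∀ {m i j} → m ∣ j → (m ∣ i) ⇔ (m ∣ i + j)
∣⇔∣+ m∣j = mk⇔ (λ m∣i → ∣m∣n⇒∣m+n m∣i m∣j) (λ m∣i+j → ∣m+n∣n⇒∣m m∣i+j m∣j)

i≤+∣i∣ : ∀ i → i ≤ + ∣ i ∣
i≤+∣i∣ (+ _)      = ≤-refl
i≤+∣i∣ -[1+ _ ] = -≤+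

m≤m*[1+k] : ∀ m k → + m ≤ + m * + suc k
m≤m*[1+k] m k = subst (+ m ≤_) (pos-* m (suc k)) (+≤+ (ℕₚ.m≤m*n m (suc k)))

≤+∣-∣* : ∀ u T K → u ≤ T + + ∣ u - T ∣ * + suc K
≤+∣-∣* u T K = subst (_≤ T + + ∣ u - T ∣ * + suc K) (T+[u-T]≡u u T)
  (+-monoʳ-≤ T (≤-trans (i≤+∣i∣ (u - T)) (m≤m*[1+k] ∣ u - T ∣ K)))
  where
  T+[u-T]≡u : ∀ u T → T + (u - T) ≡ u
  T+[u-T]≡u = solve-∀

-∣-∣*≤ : ∀ u T K → u - + ∣ u - T ∣ * + suc K ≤ T
-∣-∣*≤ u T K = subst (u - X ≤_) (T+X-X≡T T X) (+-monoˡ-≤ (- X) (≤+∣-∣* u T K))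
  where
  X = + ∣ u - T ∣ * + suc K
  T+X-X≡T : ∀ T X → T + X - X ≡ T
  T+X-X≡T = solve-∀

Env : ℕ → Set
Env n = Fin n → ℤ

dot : Vec ℤ n → Env n → ℤ
dot []       ρ = 0ℤ
dot (a ∷ as) ρ = a * ρ zero + dot as (ρ ∘ suc)

0*x+u≡u : ∀ x u → 0ℤ * x + u ≡ u
0*x+u≡u = solve-∀

unit : Fin n → Vec ℤ n
unit zero    = 1ℤ ∷ replicate _ 0ℤ
unit (suc i) = 0ℤ ∷ unit i

dot-zipWith-+ : ∀ (as bs : Vec ℤ n) ρ → dot (zipWith _+_ as bs) ρ ≡ dot as ρ + dot bs ρ
dot-zipWith-+ []       []       ρ = refl
dot-zipWith-+ (a ∷ as) (b ∷ bs) ρ = begin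
  (a + b) * ρ zero + dot (zipWith _+_ as bs) (ρ ∘ suc)
    ≡⟨ cong (_+_ ((a + b) * ρ zero)) (dot-zipWith-+ as bs (ρ ∘ suc)) ⟩
  (a + b) * ρ zero + (dot as (ρ ∘ suc) + dot bs (ρ ∘ suc))
    ≡⟨ interchange a b (ρ zero) _ _ ⟩
  (a * ρ zero + dot as (ρ ∘ suc)) + (b * ρ zero + dot bs (ρ ∘ suc)) ∎
  where
  open ≡-Reasoning
  interchange : ∀ a b x u v → (a + b) * x + (u + v) ≡ (a * x + u) + (b * x + v)
  interchange = solve-∀

dot-map-* : ∀ k (as : Vec ℤ n) ρ → dot (map (k *_) as) ρ ≡ k * dot as ρ
dot-map-* k []       ρ = sym (*-zeroʳ k)
dot-map-* k (a ∷ as) ρ = begin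
  k * a * ρ zero + dot (map (k *_) as) (ρ ∘ suc) ≡⟨ cong (_+_ (k * a * ρ zero)) (dot-map-* k as (ρ ∘ suc)) ⟩
  k * a * ρ zero + k * dot as (ρ ∘ suc)          ≡⟨ factor k a (ρ zero) _ ⟩
  k * (a * ρ zero + dot as (ρ ∘ suc))            ∎
  where
  open ≡-Reasoning
  factor : ∀ k a x u → k * a * x + k * u ≡ k * (a * x + u)
  factor = solve-∀

dot-replicate-0 : ∀ n (ρ : Env n) → dot (replicate n 0ℤ) ρ ≡ 0ℤ
dot-replicate-0 zero    ρ = refl
dot-replicate-0 (suc n) ρ =
  trans (cong (_+_ (0ℤ * ρ zero)) (dot-replicate-0 n (ρ ∘ suc))) (0*x+u≡u (ρ zero) 0ℤ)

dot-unit : ∀ (i : Fin n) ρ → dot (unit i) ρ ≡ ρ i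
dot-unit zero    ρ = trans (cong (_+_ (1ℤ * ρ zero)) (dot-replicate-0 _ (ρ ∘ suc))) (1*x+0≡x (ρ zero))
  where
  1*x+0≡x : ∀ x → 1ℤ * x + 0ℤ ≡ x
  1*x+0≡x = solve-∀
dot-unit (suc i) ρ = trans (cong (_+_ (0ℤ * ρ zero)) (dot-unit i (ρ ∘ suc))) (0*x+u≡u (ρ zero) _)

dot-cong : ∀ (as : Vec ℤ n) {ρ σ} → ρ ≗ σ → dot as ρ ≡ dot as σ
dot-cong []       ρ≗σ = refl
dot-cong (a ∷ as) ρ≗σ = cong₂ (λ x u → a * x + u) (ρ≗σ zero) (dot-cong as (ρ≗σ ∘ suc))

record Linear (n : ℕ) : Set where
  constructor linear
  field
    constant : ℤ
    coeffs   : Vec ℤ n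

⟦_⟧ₗ : Linear n → Env n → ℤ
⟦ linear c as ⟧ₗ ρ = c + dot as ρ

infixl 6 _+ₗ_ _-ₗ_
infixl 7 _·ₗ_

_+ₗ_ : Linear n → Linear n → Linear n
linear c as +ₗ linear d bs = linear (c + d) (zipWith _+_ as bs)

_·ₗ_ : ℤ → Linear n → Linear n
k ·ₗ linear c as = linear (k * c) (map (k *_) as)

_-ₗ_ : Linear n → Linear n → Linear n
l -ₗ m = l +ₗ -1ℤ ·ₗ m

constₗ : ℤ → Linear n
constₗ c = linear c (replicate _ 0ℤ)

varₗ : Fin n → Linear n
varₗ i = linear 0ℤ (unit i)

⟦+ₗ⟧ : ∀ (l m : Linear n) ρ → ⟦ l +ₗ m ⟧ₗ ρ ≡ ⟦ l ⟧ₗ ρ + ⟦ m ⟧ₗ ρ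
⟦+ₗ⟧ (linear c as) (linear d bs) ρ =
  trans (cong (_+_ (c + d)) (dot-zipWith-+ as bs ρ)) (interchange c d _ _)
  where
  interchange : ∀ c d u v → c + d + (u + v) ≡ c + u + (d + v)
  interchange = solve-∀

⟦·ₗ⟧ : ∀ k (l : Linear n) ρ → ⟦ k ·ₗ l ⟧ₗ ρ ≡ k * ⟦ l ⟧ₗ ρ
⟦·ₗ⟧ k (linear c as) ρ = trans (cong (_+_ (k * c)) (dot-map-* k as ρ)) (sym (*-distribˡ-+ k c _))

⟦-ₗ⟧ : ∀ (l m : Linear n) ρ → ⟦ l -ₗ m ⟧ₗ ρ ≡ ⟦ l ⟧ₗ ρ - ⟦ m ⟧ₗ ρ
⟦-ₗ⟧ l m ρ = trans (⟦+ₗ⟧ l (-1ℤ ·ₗ m) ρ) (cong (_+_ (⟦ l ⟧ₗ ρ)) (trans (⟦·ₗ⟧ -1ℤ m ρ) (-1*i≡-i _)))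

⟦constₗ⟧ : ∀ c (ρ : Env n) → ⟦ constₗ c ⟧ₗ ρ ≡ c
⟦constₗ⟧ c ρ = trans (cong (_+_ c) (dot-replicate-0 _ ρ)) (+-identityʳ c)

⟦varₗ⟧ : ∀ (i : Fin n) ρ → ⟦ varₗ i ⟧ₗ ρ ≡ ρ i
⟦varₗ⟧ i ρ = trans (+-identityˡ _) (dot-unit i ρ)

⟦⟧ₗ-cong : ∀ (l : Linear n) {ρ σ} → ρ ≗ σ → ⟦ l ⟧ₗ ρ ≡ ⟦ l ⟧ₗ σ
⟦⟧ₗ-cong (linear c as) ρ≗σ = cong (_+_ c) (dot-cong as ρ≗σ)

⟦⟧ₗ-∷ₐ : ∀ c a (as : Vec ℤ n) x ρ → ⟦ linear c (a ∷ as) ⟧ₗ (x ∷ₐ ρ) ≡ a * x + ⟦ linear c as ⟧ₗ ρ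
⟦⟧ₗ-∷ₐ c a as x ρ = swap c (a * x) (dot as ρ)
  where
  swap : ∀ c u v → c + (u + v) ≡ u + (c + v)
  swap = solve-∀

infixr 6 _∧_
infixr 5 _∨_

-- dvd d l and ndvd d l speak about divisibility by suc d, so that no modulus is 0.
data QF (n : ℕ) : Set where
  0<_       : Linear n → QF n
  dvd ndvd  : ℕ → Linear n → QF n
  true false : QF n
  _∧_ _∨_   : QF n → QF n → QF n

⟦_⟧ : QF n → Env n → Set
⟦ 0< l ⟧     ρ = 0ℤ < ⟦ l ⟧ₗ ρ
⟦ dvd d l ⟧  ρ = + suc d ∣ ⟦ l ⟧ₗ ρ
⟦ ndvd d l ⟧ ρ = ¬ (+ suc d ∣ ⟦ l ⟧ₗ ρ)
⟦ true ⟧     ρ = ⊤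
⟦ false ⟧    ρ = ⊥
⟦ φ ∧ ψ ⟧    ρ = ⟦ φ ⟧ ρ × ⟦ ψ ⟧ ρ
⟦ φ ∨ ψ ⟧    ρ = ⟦ φ ⟧ ρ ⊎ ⟦ ψ ⟧ ρ

⟦⟧-dec : ∀ (φ : QF n) ρ → Dec (⟦ φ ⟧ ρ)
⟦⟧-dec (0< l)     ρ = 0ℤ <? ⟦ l ⟧ₗ ρ
⟦⟧-dec (dvd d l)  ρ = + suc d ∣? ⟦ l ⟧ₗ ρ
⟦⟧-dec (ndvd d l) ρ = ¬? (+ suc d ∣? ⟦ l ⟧ₗ ρ)
⟦⟧-dec true       ρ = yes tt
⟦⟧-dec false      ρ = no λ ()
⟦⟧-dec (φ ∧ ψ)    ρ = ⟦⟧-dec φ ρ ×-dec ⟦⟧-dec ψ ρ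
⟦⟧-dec (φ ∨ ψ)    ρ = ⟦⟧-dec φ ρ ⊎-dec ⟦⟧-dec ψ ρ

⟦⟧-cong : ∀ (φ : QF n) {ρ σ} → ρ ≗ σ → ⟦ φ ⟧ ρ ⇔ ⟦ φ ⟧ σ
⟦⟧-cong (0< l)     ρ≗σ = subst-⇔ (0ℤ <_) (⟦⟧ₗ-cong l ρ≗σ)
⟦⟧-cong (dvd d l)  ρ≗σ = subst-⇔ (+ suc d ∣_) (⟦⟧ₗ-cong l ρ≗σ)
⟦⟧-cong (ndvd d l) ρ≗σ = subst-⇔ (λ i → ¬ (+ suc d ∣ i)) (⟦⟧ₗ-cong l ρ≗σ)
⟦⟧-cong true       ρ≗σ = ⇔-refl
⟦⟧-cong false      ρ≗σ = ⇔-refl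
⟦⟧-cong (φ ∧ ψ)    ρ≗σ = ⟦⟧-cong φ ρ≗σ ×-⇔ ⟦⟧-cong ψ ρ≗σ
⟦⟧-cong (φ ∨ ψ)    ρ≗σ = ⟦⟧-cong φ ρ≗σ ⊎-⇔ ⟦⟧-cong ψ ρ≗σ

neg : QF n → QF n
neg (0< l)     = 0< (constₗ 1ℤ -ₗ l)
neg (dvd d l)  = ndvd d l
neg (ndvd d l) = dvd d l
neg true       = false
neg false      = true
neg (φ ∧ ψ)    = neg φ ∨ neg ψ
neg (φ ∨ ψ)    = neg φ ∧ neg ψ

⟦neg⟧ : ∀ (φ : QF n) ρ → ⟦ neg φ ⟧ ρ ⇔ (¬ ⟦ φ ⟧ ρ)
⟦neg⟧ (0< l)     ρ = ⇔-trans (subst-⇔ (0ℤ <_) 1-l) (⇔-sym ¬0<⇔0<1-)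
  where
  1-l : ⟦ constₗ 1ℤ -ₗ l ⟧ₗ ρ ≡ 1ℤ - ⟦ l ⟧ₗ ρ
  1-l = trans (⟦-ₗ⟧ (constₗ 1ℤ) l ρ) (cong (_- ⟦ l ⟧ₗ ρ) (⟦constₗ⟧ 1ℤ ρ))
⟦neg⟧ (dvd d l)  ρ = ⇔-refl
⟦neg⟧ (ndvd d l) ρ = ⇔-sym (¬¬⇔ (+ suc d ∣? ⟦ l ⟧ₗ ρ))
⟦neg⟧ true       ρ = mk⇔ ⊥-elim (λ ¬⊤ → ¬⊤ tt)
⟦neg⟧ false      ρ = mk⇔ (λ _ ()) (λ _ → tt)
⟦neg⟧ (φ ∧ ψ)    ρ = ⇔-trans (⟦neg⟧ φ ρ ⊎-⇔ ⟦neg⟧ ψ ρ) (¬⊎¬⇔¬× (⟦⟧-dec φ ρ))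
⟦neg⟧ (φ ∨ ψ)    ρ = ⇔-trans (⟦neg⟧ φ ρ ×-⇔ ⟦neg⟧ ψ ρ) ¬×¬⇔¬⊎

⟦⟧⇔¬⟦neg⟧ : ∀ (φ : QF n) ρ → ⟦ φ ⟧ ρ ⇔ (¬ ⟦ neg φ ⟧ ρ)
⟦⟧⇔¬⟦neg⟧ φ ρ = ⇔-trans (⇔-sym (¬¬⇔ (⟦⟧-dec φ ρ))) (¬-⇔ (⇔-sym (⟦neg⟧ φ ρ)))

infix 4 _<ₗ_ _≐ₗ_

_<ₗ_ : Linear n → Linear n → QF n
l <ₗ m = 0< (m -ₗ l)

_≐ₗ_ : Linear n → Linear n → QF n
l ≐ₗ m = neg (l <ₗ m) ∧ neg (m <ₗ l)

⟦<ₗ⟧ : ∀ (l m : Linear n) ρ → ⟦ l <ₗ m ⟧ ρ ⇔ ⟦ l ⟧ₗ ρ < ⟦ m ⟧ₗ ρ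
⟦<ₗ⟧ l m ρ = ⇔-trans (subst-⇔ (0ℤ <_) (⟦-ₗ⟧ m l ρ)) 0<-⇔<

⟦≐ₗ⟧ : ∀ (l m : Linear n) ρ → ⟦ l ≐ₗ m ⟧ ρ ⇔ ⟦ l ⟧ₗ ρ ≡ ⟦ m ⟧ₗ ρ
⟦≐ₗ⟧ l m ρ = ⇔-trans
  ((⇔-trans (⟦neg⟧ (l <ₗ m) ρ) (¬-⇔ (⟦<ₗ⟧ l m ρ))) ×-⇔ (⇔-trans (⟦neg⟧ (m <ₗ l) ρ) (¬-⇔ (⟦<ₗ⟧ m l ρ))))
  (⇔-sym ≡⇔≮×≯)

anyOf : (A → QF n) → List A → QF n
anyOf f []       = false
anyOf f (x ∷ xs) = f x ∨ anyOf f xs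

⟦anyOf⟧ : ∀ (f : A → QF n) xs ρ → ⟦ anyOf f xs ⟧ ρ ⇔ Any (λ x → ⟦ f x ⟧ ρ) xs
⟦anyOf⟧ f xs ρ = mk⇔ (to′ xs) (from′ xs)
  where
  to′ : ∀ xs → ⟦ anyOf f xs ⟧ ρ → Any (λ x → ⟦ f x ⟧ ρ) xs
  to′ (x ∷ xs) (inj₁ s) = here s
  to′ (x ∷ xs) (inj₂ s) = there (to′ xs s)
  from′ : ∀ xs → Any (λ x → ⟦ f x ⟧ ρ) xs → ⟦ anyOf f xs ⟧ ρ
  from′ (x ∷ xs) (here s)  = inj₁ s
  from′ (x ∷ xs) (there s) = inj₂ (from′ xs s)

-- Piecewise linear terms

infixl 1 _>>=_

data Piecewise (n : ℕ) : Set where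
  leaf          : Linear n → Piecewise n
  if_then_else_ : QF n → Piecewise n → Piecewise n → Piecewise n

Evaluates : Piecewise n → Env n → ℤ → Set
Evaluates (leaf l)             ρ z = ⟦ l ⟧ₗ ρ ≡ z
Evaluates (if g then p else q) ρ z = (⟦ g ⟧ ρ × Evaluates p ρ z) ⊎ (¬ ⟦ g ⟧ ρ × Evaluates q ρ z)

_>>=_ : Piecewise n → (Linear n → Piecewise n) → Piecewise n
leaf l                 >>= h = h l
(if g then p else q) >>= h = if g then (p >>= h) else (q >>= h)

Evaluates->>= : ∀ {p : Piecewise n} {h ρ z} (g : ℤ → ℤ) →
                (∀ l → Evaluates (h l) ρ (g (⟦ l ⟧ₗ ρ))) → Evaluates p ρ z → Evaluates (p >>= h) ρ (g z)
Evaluates->>= {p = leaf l}             g H refl             = H l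
Evaluates->>= {p = if _ then p else _} g H (inj₁ (s , ev)) = inj₁ (s , Evaluates->>= {p = p} g H ev)
Evaluates->>= {p = if _ then _ else q} g H (inj₂ (s , ev)) = inj₂ (s , Evaluates->>= {p = q} g H ev)

lift₂ : (Linear n → Linear n → Piecewise n) → Piecewise n → Piecewise n → Piecewise n
lift₂ f p q = p >>= λ l → q >>= f l

Evaluates-lift₂ : ∀ {f : Linear n → Linear n → Piecewise n} {ρ} (_∙_ : ℤ → ℤ → ℤ) →
                  (∀ l m → Evaluates (f l m) ρ (⟦ l ⟧ₗ ρ ∙ ⟦ m ⟧ₗ ρ)) →
                  ∀ {p q a b} → Evaluates p ρ a → Evaluates q ρ b → Evaluates (lift₂ f p q) ρ (a ∙ b)
Evaluates-lift₂ {ρ = ρ} _∙_ H {p} {q} {b = b} evₚ evq =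
  Evaluates->>= {p = p} (_∙ b) (λ l → Evaluates->>= {p = q} (⟦ l ⟧ₗ ρ ∙_) (H l) evq) evₚ

atLeaves : Piecewise n → (Linear n → QF n) → QF n
atLeaves (leaf l)             h = h l
atLeaves (if g then p else q) h = (g ∧ atLeaves p h) ∨ (neg g ∧ atLeaves q h)

⟦atLeaves⟧ : ∀ {p : Piecewise n} {h ρ z} (R : ℤ → Set) →
             (∀ l → ⟦ h l ⟧ ρ ⇔ R (⟦ l ⟧ₗ ρ)) → Evaluates p ρ z → ⟦ atLeaves p h ⟧ ρ ⇔ R z
⟦atLeaves⟧ {p = leaf l} R H refl = H l
⟦atLeaves⟧ {p = if g then p else _} {ρ = ρ} R H (inj₁ (s , ev)) = mk⇔
  (λ { (inj₁ (_ , t)) → to IH t ; (inj₂ (¬s , _)) → contradiction s (to (⟦neg⟧ g ρ) ¬s) })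
  (λ r → inj₁ (s , from IH r))
  where IH = ⟦atLeaves⟧ {p = p} R H ev
⟦atLeaves⟧ {p = if g then _ else q} {ρ = ρ} R H (inj₂ (¬s , ev)) = mk⇔
  (λ { (inj₁ (s , _)) → contradiction s ¬s ; (inj₂ (_ , t)) → to IH t })
  (λ r → inj₂ (from (⟦neg⟧ g ρ) ¬s , from IH r))
  where IH = ⟦atLeaves⟧ {p = q} R H ev

_⊓ₚ_ _⊔ₚ_ : Linear n → Linear n → Piecewise n
l ⊓ₚ m = if l <ₗ m then leaf l else leaf m
l ⊔ₚ m = if l <ₗ m then leaf m else leaf l

Evaluates-⊓ₚ : ∀ (l m : Linear n) ρ → Evaluates (l ⊓ₚ m) ρ (⟦ l ⟧ₗ ρ ⊓ ⟦ m ⟧ₗ ρ)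
Evaluates-⊓ₚ l m ρ with ⟦⟧-dec (l <ₗ m) ρ
... | yes l<m = inj₁ (l<m , sym (i≤j⇒i⊓j≡i (<⇒≤ (to (⟦<ₗ⟧ l m ρ) l<m))))
... | no l≮m  = inj₂ (l≮m , sym (i≥j⇒i⊓j≡j (≮⇒≥ (l≮m ∘ from (⟦<ₗ⟧ l m ρ)))))

Evaluates-⊔ₚ : ∀ (l m : Linear n) ρ → Evaluates (l ⊔ₚ m) ρ (⟦ l ⟧ₗ ρ ⊔ ⟦ m ⟧ₗ ρ)
Evaluates-⊔ₚ l m ρ with ⟦⟧-dec (l <ₗ m) ρ
... | yes l<m = inj₁ (l<m , sym (i≤j⇒i⊔j≡j (<⇒≤ (to (⟦<ₗ⟧ l m ρ) l<m))))
... | no l≮m  = inj₂ (l≮m , sym (i≥j⇒i⊔j≡i (≮⇒≥ (l≮m ∘ from (⟦<ₗ⟧ l m ρ)))))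

⟪_⟫ : Term n → Piecewise n
⟪ var i ⟫ = leaf (varₗ i)
⟪ zer ⟫   = leaf (constₗ 0ℤ)
⟪ s ⊕ t ⟫ = lift₂ (λ l m → leaf (l +ₗ m)) ⟪ s ⟫ ⟪ t ⟫
⟪ s ⋀ t ⟫ = lift₂ _⊓ₚ_ ⟪ s ⟫ ⟪ t ⟫
⟪ s ⋁ t ⟫ = lift₂ _⊔ₚ_ ⟪ s ⟫ ⟪ t ⟫

Evaluates-⟪⟫ : ∀ (t : Term n) ρ → Evaluates ⟪ t ⟫ ρ (eval t ρ)
Evaluates-⟪⟫ (var i) ρ = ⟦varₗ⟧ i ρ
Evaluates-⟪⟫ zer     ρ = ⟦constₗ⟧ 0ℤ ρ
Evaluates-⟪⟫ (s ⊕ t) ρ = Evaluates-lift₂ _+_ (λ l m → ⟦+ₗ⟧ l m ρ) (Evaluates-⟪⟫ s ρ) (Evaluates-⟪⟫ t ρ)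
Evaluates-⟪⟫ (s ⋀ t) ρ = Evaluates-lift₂ _⊓_ (λ l m → Evaluates-⊓ₚ l m ρ) (Evaluates-⟪⟫ s ρ) (Evaluates-⟪⟫ t ρ)
Evaluates-⟪⟫ (s ⋁ t) ρ = Evaluates-lift₂ _⊔_ (λ l m → Evaluates-⊔ₚ l m ρ) (Evaluates-⟪⟫ s ρ) (Evaluates-⟪⟫ t ρ)

-- Cooper's elimination of one unit-coefficient variable

-- Formulas in an extra variable y, kept outside the environment, that has coefficient ±1
-- in every order atom.
data Cooper (n : ℕ) : Set where
  _<y y<_   : Linear n → Cooper n
  dvd ndvd  : ℕ → ℤ → Linear n → Cooper n
  free      : QF n → Cooper n
  _∧_ _∨_   : Cooper n → Cooper n → Cooper n

⟦_⟧ᶜ : Cooper n → ℤ → Env n → Set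
⟦ t <y ⟧ᶜ       y ρ = ⟦ t ⟧ₗ ρ < y
⟦ y< t ⟧ᶜ       y ρ = y < ⟦ t ⟧ₗ ρ
⟦ dvd d a t ⟧ᶜ  y ρ = + suc d ∣ a * y + ⟦ t ⟧ₗ ρ
⟦ ndvd d a t ⟧ᶜ y ρ = ¬ (+ suc d ∣ a * y + ⟦ t ⟧ₗ ρ)
⟦ free φ ⟧ᶜ     y ρ = ⟦ φ ⟧ ρ
⟦ φ ∧ ψ ⟧ᶜ      y ρ = ⟦ φ ⟧ᶜ y ρ × ⟦ ψ ⟧ᶜ y ρ
⟦ φ ∨ ψ ⟧ᶜ      y ρ = ⟦ φ ⟧ᶜ y ρ ⊎ ⟦ ψ ⟧ᶜ y ρ

_[_] : Cooper n → Linear n → QF n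
(t <y)     [ s ] = t <ₗ s
(y< t)     [ s ] = s <ₗ t
dvd d a t  [ s ] = dvd d (a ·ₗ s +ₗ t)
ndvd d a t [ s ] = ndvd d (a ·ₗ s +ₗ t)
free φ     [ s ] = φ
(φ ∧ ψ)    [ s ] = φ [ s ] ∧ ψ [ s ]
(φ ∨ ψ)    [ s ] = φ [ s ] ∨ ψ [ s ]

⟦a·s+t⟧ : ∀ a (s t : Linear n) ρ → ⟦ a ·ₗ s +ₗ t ⟧ₗ ρ ≡ a * ⟦ s ⟧ₗ ρ + ⟦ t ⟧ₗ ρ
⟦a·s+t⟧ a s t ρ = trans (⟦+ₗ⟧ (a ·ₗ s) t ρ) (cong (_+ ⟦ t ⟧ₗ ρ) (⟦·ₗ⟧ a s ρ))

⟦[]⟧ : ∀ (φ : Cooper n) s ρ → ⟦ φ [ s ] ⟧ ρ ⇔ ⟦ φ ⟧ᶜ (⟦ s ⟧ₗ ρ) ρ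
⟦[]⟧ (t <y)       s ρ = ⟦<ₗ⟧ t s ρ
⟦[]⟧ (y< t)       s ρ = ⟦<ₗ⟧ s t ρ
⟦[]⟧ (dvd d a t)  s ρ = subst-⇔ (+ suc d ∣_) (⟦a·s+t⟧ a s t ρ)
⟦[]⟧ (ndvd d a t) s ρ = subst-⇔ (λ i → ¬ (+ suc d ∣ i)) (⟦a·s+t⟧ a s t ρ)
⟦[]⟧ (free φ)     s ρ = ⇔-refl
⟦[]⟧ (φ ∧ ψ)      s ρ = ⟦[]⟧ φ s ρ ×-⇔ ⟦[]⟧ ψ s ρ
⟦[]⟧ (φ ∨ ψ)      s ρ = ⟦[]⟧ φ s ρ ⊎-⇔ ⟦[]⟧ ψ s ρ

_₋∞ : Cooper n → Cooper n
(t <y)  ₋∞ = free false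
(y< t)  ₋∞ = free true
(φ ∧ ψ) ₋∞ = φ ₋∞ ∧ ψ ₋∞
(φ ∨ ψ) ₋∞ = φ ₋∞ ∨ ψ ₋∞
φ       ₋∞ = φ

lowerBounds : Cooper n → List (Linear n)
lowerBounds (t <y)  = t ∷ []
lowerBounds (φ ∧ ψ) = lowerBounds φ ++ lowerBounds ψ
lowerBounds (φ ∨ ψ) = lowerBounds φ ++ lowerBounds ψ
lowerBounds _       = []

ModuliDivide : ℤ → Cooper n → Set
ModuliDivide D (dvd d _ _)  = + suc d ∣ D
ModuliDivide D (ndvd d _ _) = + suc d ∣ D
ModuliDivide D (φ ∧ ψ)      = ModuliDivide D φ × ModuliDivide D ψ
ModuliDivide D (φ ∨ ψ)      = ModuliDivide D φ × ModuliDivide D ψ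
ModuliDivide D _            = ⊤

ModuliDivide-∣ : ∀ (φ : Cooper n) {D E} → D ∣ E → ModuliDivide D φ → ModuliDivide E φ
ModuliDivide-∣ (t <y)       D∣E _         = tt
ModuliDivide-∣ (y< t)       D∣E _         = tt
ModuliDivide-∣ (dvd d a t)  D∣E m∣D       = ∣-trans m∣D D∣E
ModuliDivide-∣ (ndvd d a t) D∣E m∣D       = ∣-trans m∣D D∣E
ModuliDivide-∣ (free φ)     D∣E _         = tt
ModuliDivide-∣ (φ ∧ ψ)      D∣E (mφ , mψ) = ModuliDivide-∣ φ D∣E mφ , ModuliDivide-∣ ψ D∣E mψ
ModuliDivide-∣ (φ ∨ ψ)      D∣E (mφ , mψ) = ModuliDivide-∣ φ D∣E mφ , ModuliDivide-∣ ψ D∣E mψ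

-- suc (m ⊗ k) ≡ suc m ℕ.* suc k holds definitionally.
_⊗_ : ℕ → ℕ → ℕ
m ⊗ k = k ℕ.+ m ℕ.* suc k

suc∣suc-⊗ˡ : ∀ m k → + suc m ∣ + suc (m ⊗ k)
suc∣suc-⊗ˡ m k = subst (+ suc m ∣_) (sym (pos-* (suc m) (suc k))) (∣m⇒∣m*n (+ suc k) ∣-refl)

suc∣suc-⊗ʳ : ∀ m k → + suc k ∣ + suc (m ⊗ k)
suc∣suc-⊗ʳ m k = subst (+ suc k ∣_) (sym (pos-* (suc m) (suc k))) (∣n⇒∣m*n (+ suc m) ∣-refl)

-- The period of φ is suc (period φ).
period : Cooper n → ℕ
period (dvd d _ _)  = d
period (ndvd d _ _) = d
period (φ ∧ ψ)      = period φ ⊗ period ψ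
period (φ ∨ ψ)      = period φ ⊗ period ψ
period _            = 0

ModuliDivide-period : ∀ (φ : Cooper n) → ModuliDivide (+ suc (period φ)) φ
ModuliDivide-period (t <y)       = tt
ModuliDivide-period (y< t)       = tt
ModuliDivide-period (dvd d a t)  = ∣-refl
ModuliDivide-period (ndvd d a t) = ∣-refl
ModuliDivide-period (free φ)     = tt
ModuliDivide-period (φ ∧ ψ)      = ModuliDivide-∣ φ (suc∣suc-⊗ˡ _ _) (ModuliDivide-period φ)
                                 , ModuliDivide-∣ ψ (suc∣suc-⊗ʳ (period φ) _) (ModuliDivide-period ψ)
ModuliDivide-period (φ ∨ ψ)      = ModuliDivide-∣ φ (suc∣suc-⊗ˡ _ _) (ModuliDivide-period φ)
                                 , ModuliDivide-∣ ψ (suc∣suc-⊗ʳ (period φ) _) (ModuliDivide-period ψ)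

∣-shift : ∀ {m} s a y t → m ∣ s → (m ∣ a * y + t) ⇔ (m ∣ a * (y + s) + t)
∣-shift s a y t m∣s = ⇔-trans (∣⇔∣+ (∣n⇒∣m*n a m∣s)) (subst-⇔ (_ ∣_) (regroup a y s t))
  where
  regroup : ∀ a y s t → a * y + t + a * s ≡ a * (y + s) + t
  regroup = solve-∀

₋∞-shift : ∀ (φ : Cooper n) {s y ρ} → ModuliDivide s φ → ⟦ φ ₋∞ ⟧ᶜ y ρ → ⟦ φ ₋∞ ⟧ᶜ (y + s) ρ
₋∞-shift (t <y)       _         ()
₋∞-shift (y< t)       _         _         = tt
₋∞-shift (dvd d a t)  m∣s       s         = to (∣-shift _ a _ _ m∣s) s
₋∞-shift (ndvd d a t) m∣s       ¬s        = ¬s ∘ from (∣-shift _ a _ _ m∣s)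
₋∞-shift (free φ)     _         s         = s
₋∞-shift (φ ∧ ψ)      (mφ , mψ) (sφ , sψ) = ₋∞-shift φ mφ sφ , ₋∞-shift ψ mψ sψ
₋∞-shift (φ ∨ ψ)      (mφ , mψ) s         = Sum.map (₋∞-shift φ mφ) (₋∞-shift ψ mψ) s

₋∞-threshold : ∀ (φ : Cooper n) ρ → ∃[ T ] (∀ {y} → y ≤ T → ⟦ φ ⟧ᶜ y ρ ⇔ ⟦ φ ₋∞ ⟧ᶜ y ρ)
₋∞-threshold (t <y)       ρ = ⟦ t ⟧ₗ ρ , λ y≤t → mk⇔ (≤⇒≯ y≤t) ⊥-elim
₋∞-threshold (y< t)       ρ = pred (⟦ t ⟧ₗ ρ) , λ y≤t-1 → mk⇔ (λ _ → tt) (λ _ → i≤pred[j]⇒i<j y≤t-1)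
₋∞-threshold (dvd d a t)  ρ = 0ℤ , λ _ → ⇔-refl
₋∞-threshold (ndvd d a t) ρ = 0ℤ , λ _ → ⇔-refl
₋∞-threshold (free φ)     ρ = 0ℤ , λ _ → ⇔-refl
₋∞-threshold (φ ∧ ψ)      ρ with ₋∞-threshold φ ρ | ₋∞-threshold ψ ρ
... | T₁ , H₁ | T₂ , H₂ = T₁ ⊓ T₂ , λ y≤ → H₁ (≤-trans y≤ (i⊓j≤i T₁ T₂)) ×-⇔ H₂ (≤-trans y≤ (i⊓j≤j T₁ T₂))
₋∞-threshold (φ ∨ ψ)      ρ with ₋∞-threshold φ ρ | ₋∞-threshold ψ ρ
... | T₁ , H₁ | T₂ , H₂ = T₁ ⊓ T₂ , λ y≤ → H₁ (≤-trans y≤ (i⊓j≤i T₁ T₂)) ⊎-⇔ H₂ (≤-trans y≤ (i⊓j≤j T₁ T₂))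

split-above : ∀ K {b y} → b < y → (∃[ r ] (r ℕ.≤ K × y ≡ b + + suc r)) ⊎ b < y - + suc K
split-above K {b} {y} b<y with 0<⇒≡+[1+] (from 0<-⇔< b<y)
... | r , y-b≡1+r with r ℕ.≤? K
...   | yes r≤K = inj₁ (r , r≤K , trans (sym (b+[y-b]≡y b y)) (cong (_+_ b) y-b≡1+r))
  where
  b+[y-b]≡y : ∀ b y → b + (y - b) ≡ y
  b+[y-b]≡y = solve-∀
...   | no r≰K  = inj₂ (to 0<-⇔< (subst (0ℤ <_) y-D-b (from 0<-⇔< (+<+ (s≤s (ℕₚ.≰⇒> r≰K))))))
  where
  swap : ∀ y b D → y - b - D ≡ y - D - b
  swap = solve-∀
  y-D-b : + suc r - + suc K ≡ y - + suc K - b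
  y-D-b = trans (cong (_- + suc K) (sym y-b≡1+r)) (swap y b (+ suc K))

JustAbove : List (Linear n) → ℕ → ℤ → Env n → Set
JustAbove bs K y ρ = ∃[ b ] (b ∈ bs × ∃[ r ] (r ℕ.≤ K × y ≡ ⟦ b ⟧ₗ ρ + + suc r))

JustAbove-++⁺ˡ : ∀ {bs cs : List (Linear n)} {K y ρ} → JustAbove bs K y ρ → JustAbove (bs ++ cs) K y ρ
JustAbove-++⁺ˡ (b , b∈ , near) = b , ∈-++⁺ˡ b∈ , near

JustAbove-++⁺ʳ : ∀ (bs : List (Linear n)) {cs K y ρ} → JustAbove cs K y ρ → JustAbove (bs ++ cs) K y ρ
JustAbove-++⁺ʳ bs (b , b∈ , near) = b , ∈-++⁺ʳ bs b∈ , near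

descend : ∀ (φ : Cooper n) K {y ρ} → ModuliDivide (+ suc K) φ → ⟦ φ ⟧ᶜ y ρ →
          JustAbove (lowerBounds φ) K y ρ ⊎ ⟦ φ ⟧ᶜ (y - + suc K) ρ
descend (t <y)       K     _         t<y       = Sum.map₁ (λ near → t , here refl , near) (split-above K t<y)
descend (y< t)       K {y} _         y<t       = inj₂ (≤-<-trans (i-j≤i y (+ suc K)) y<t)
descend (dvd d a t)  K     m∣D       s         = inj₂ (to (∣-shift _ a _ _ (∣m⇒∣-m m∣D)) s)
descend (ndvd d a t) K     m∣D       ¬s        = inj₂ (¬s ∘ from (∣-shift _ a _ _ (∣m⇒∣-m m∣D)))
descend (free φ)     K     _         s         = inj₂ s
descend (φ ∧ ψ)      K     (mφ , mψ) (sφ , sψ) with descend φ K mφ sφ | descend ψ K mψ sψ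
... | inj₁ near | _         = inj₁ (JustAbove-++⁺ˡ near)
... | inj₂ _    | inj₁ near = inj₁ (JustAbove-++⁺ʳ (lowerBounds φ) near)
... | inj₂ sφ′  | inj₂ sψ′  = inj₂ (sφ′ , sψ′)
descend (φ ∨ ψ)      K     (mφ , _)  (inj₁ sφ) = Sum.map JustAbove-++⁺ˡ inj₁ (descend φ K mφ sφ)
descend (φ ∨ ψ)      K     (_ , mψ)  (inj₂ sψ) = Sum.map (JustAbove-++⁺ʳ (lowerBounds φ)) inj₂ (descend ψ K mψ sψ)

cooper₋∞ cooperBounds cooper : ℕ → Cooper n → QF n
cooper₋∞     K φ = anyOf (λ r → φ ₋∞ [ constₗ (+ r) ]) (downFrom (suc K))
cooperBounds K φ = anyOf (λ r → anyOf (λ b → φ [ b +ₗ constₗ (+ suc r) ]) (lowerBounds φ)) (downFrom (suc K))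
cooper       K φ = cooper₋∞ K φ ∨ cooperBounds K φ

⟦[constₗ]⟧ : ∀ (φ : Cooper n) c ρ → ⟦ φ [ constₗ c ] ⟧ ρ ⇔ ⟦ φ ⟧ᶜ c ρ
⟦[constₗ]⟧ φ c ρ = ⇔-trans (⟦[]⟧ φ (constₗ c) ρ) (subst-⇔ (λ z → ⟦ φ ⟧ᶜ z ρ) (⟦constₗ⟧ c ρ))

⟦cooper₋∞⟧ : ∀ K (φ : Cooper n) ρ → ⟦ cooper₋∞ K φ ⟧ ρ ⇔ (∃[ r ] (r ℕ.< suc K × ⟦ φ ₋∞ ⟧ᶜ (+ r) ρ))
⟦cooper₋∞⟧ K φ ρ = ⇔-trans (⟦anyOf⟧ _ (downFrom (suc K)) ρ) (mk⇔
  (λ any → let r , r∈ , s = find any in r , ∈-downFrom⁻ r∈ , to (⟦[constₗ]⟧ (φ ₋∞) (+ r) ρ) s)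
  (λ { (r , r<1+K , s) → lose (∈-downFrom⁺ r<1+K) (from (⟦[constₗ]⟧ (φ ₋∞) (+ r) ρ) s) }))

⟦cooperBounds⟧ : ∀ K (φ : Cooper n) ρ →
                 ⟦ cooperBounds K φ ⟧ ρ ⇔ (∃[ y ] (JustAbove (lowerBounds φ) K y ρ × ⟦ φ ⟧ᶜ y ρ))
⟦cooperBounds⟧ K φ ρ = ⇔-trans (⟦anyOf⟧ _ (downFrom (suc K)) ρ) (mk⇔ to′ from′)
  where
  ⟦b+1+r⟧ : ∀ b r → ⟦ b +ₗ constₗ (+ suc r) ⟧ₗ ρ ≡ ⟦ b ⟧ₗ ρ + + suc r
  ⟦b+1+r⟧ b r = trans (⟦+ₗ⟧ b (constₗ (+ suc r)) ρ) (cong (_+_ (⟦ b ⟧ₗ ρ)) (⟦constₗ⟧ (+ suc r) ρ))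
  at : ∀ b r → ⟦ φ [ b +ₗ constₗ (+ suc r) ] ⟧ ρ ⇔ ⟦ φ ⟧ᶜ (⟦ b ⟧ₗ ρ + + suc r) ρ
  at b r = ⇔-trans (⟦[]⟧ φ _ ρ) (subst-⇔ (λ z → ⟦ φ ⟧ᶜ z ρ) (⟦b+1+r⟧ b r))
  to′ : Any _ (downFrom (suc K)) → ∃[ y ] (JustAbove (lowerBounds φ) K y ρ × ⟦ φ ⟧ᶜ y ρ)
  to′ any with find any
  ... | r , r∈ , anyB with find (to (⟦anyOf⟧ _ (lowerBounds φ) ρ) anyB)
  ... | b , b∈ , s = _ , (b , b∈ , r , ℕ.s≤s⁻¹ (∈-downFrom⁻ r∈) , refl) , to (at b r) s
  from′ : ∃[ y ] (JustAbove (lowerBounds φ) K y ρ × ⟦ φ ⟧ᶜ y ρ) → Any _ (downFrom (suc K))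
  from′ (y , (b , b∈ , r , r≤K , refl) , s) =
    lose (∈-downFrom⁺ (s≤s r≤K)) (from (⟦anyOf⟧ _ (lowerBounds φ) ρ) (lose b∈ (from (at b r) s)))

cooper-sound : ∀ K (φ : Cooper n) ρ → ModuliDivide (+ suc K) φ → ⟦ cooper K φ ⟧ ρ → ∃[ y ] ⟦ φ ⟧ᶜ y ρ
cooper-sound K φ ρ m (inj₁ s) with to (⟦cooper₋∞⟧ K φ ρ) s | ₋∞-threshold φ ρ
... | r , _ , s₋∞ | T , H = _ , from (H (-∣-∣*≤ (+ r) T K)) (₋∞-shift φ (ModuliDivide-∣ φ D∣-X m) s₋∞)
  where
  D∣-X : + suc K ∣ - (+ ∣ + r - T ∣ * + suc K)
  D∣-X = ∣m⇒∣-m (∣n⇒∣m*n (+ ∣ + r - T ∣) ∣-refl)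
cooper-sound K φ ρ m (inj₂ s) with to (⟦cooperBounds⟧ K φ ρ) s
... | y , _ , sy = y , sy

₋∞-residue : ∀ K (φ : Cooper n) ρ {y} → ModuliDivide (+ suc K) φ → ⟦ φ ₋∞ ⟧ᶜ y ρ → ⟦ cooper₋∞ K φ ⟧ ρ
₋∞-residue K φ ρ {y} m s = from (⟦cooper₋∞⟧ K φ ρ) (y %ℕ suc K , n%ℕd<d y (suc K) ,
  subst (λ z → ⟦ φ ₋∞ ⟧ᶜ z ρ) y-qD≡r (₋∞-shift φ (ModuliDivide-∣ φ (∣m⇒∣-m (∣n⇒∣m*n q ∣-refl)) m) s))
  where
  q = y /ℕ suc K
  cancel : ∀ r q D → r + q * D - q * D ≡ r
  cancel = solve-∀
  y-qD≡r : y - q * + suc K ≡ + (y %ℕ suc K)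
  y-qD≡r = trans (cong (_- q * + suc K) (a≡a%ℕn+[a/ℕn]*n y (suc K))) (cancel _ q (+ suc K))

-- Starting from a solution y, step down by the period until either y lies just above a
-- lower bound, or y is below the threshold, where φ agrees with the periodic φ ₋∞.
cooper-complete : ∀ K (φ : Cooper n) ρ {y₀} → ModuliDivide (+ suc K) φ → ⟦ φ ⟧ᶜ y₀ ρ → ⟦ cooper K φ ⟧ ρ
cooper-complete K φ ρ {y₀} m s₀ with ₋∞-threshold φ ρ
... | T , H = steps ∣ y₀ - T ∣ (≤+∣-∣* y₀ T K) s₀
  where
  D = + suc K
  T+0*D≡T : ∀ T D → T + 0ℤ * D ≡ T
  T+0*D≡T = solve-∀
  T+[1+f]D-D≡T+fD : ∀ T f D → T + (1ℤ + f) * D - D ≡ T + f * D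
  T+[1+f]D-D≡T+fD = solve-∀
  steps : ∀ f {y} → y ≤ T + + f * D → ⟦ φ ⟧ᶜ y ρ → ⟦ cooper K φ ⟧ ρ
  steps zero    y≤ s = inj₁ (₋∞-residue K φ ρ m (to (H (subst (_ ≤_) (T+0*D≡T T D) y≤)) s))
  steps (suc f) {y} y≤ s with descend φ K m s
  ... | inj₁ near = inj₂ (from (⟦cooperBounds⟧ K φ ρ) (y , near , s))
  ... | inj₂ s′   = steps f (subst (y - D ≤_) (T+[1+f]D-D≡T+fD T (+ f) D) (+-monoˡ-≤ (- D) y≤)) s′

cooper-correct : ∀ K (φ : Cooper n) ρ → ModuliDivide (+ suc K) φ → (∃[ y ] ⟦ φ ⟧ᶜ y ρ) ⇔ ⟦ cooper K φ ⟧ ρ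
cooper-correct K φ ρ m = mk⇔ (λ (_ , s) → cooper-complete K φ ρ m s) (cooper-sound K φ ρ m)

-- Making the coefficient of the eliminated variable ±1

quotient-pos : ∀ L k → suc k ∣ℕ suc L → + suc L ≡ + (suc L / suc k) * + suc k × 0ℤ < + (suc L / suc k)
quotient-pos L k k∣L with suc L / suc k | m/n*n≡m {suc L} {suc k} k∣L
... | suc q | q*k≡L = trans (cong +_ (sym q*k≡L)) (pos-* (suc q) (suc k)) , +<+ (s≤s ℕ.z≤n)

lower-scale : ∀ {M} → 0ℤ < M → ∀ a x E → (0ℤ < a * x + E) ⇔ ((- M) * E < M * a * x)
lower-scale {M} 0<M a x E =
  ⇔-trans (subst-⇔ (0ℤ <_) (cong (_+_ (a * x)) (sym (neg-involutive E))))
  (⇔-trans 0<-⇔<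
  (⇔-trans (*-pos-<⇔ 0<M)
  (subst₂-⇔ _<_ (move-neg M E) (sym (*-assoc M a x)))))
  where
  move-neg : ∀ M E → M * - E ≡ - M * E
  move-neg = solve-∀

upper-scale : ∀ {M} → 0ℤ < M → ∀ a x E → (0ℤ < - a * x + E) ⇔ (M * a * x < M * E)
upper-scale {M} 0<M a x E =
  ⇔-trans (subst-⇔ (0ℤ <_) (swap a x E))
  (⇔-trans 0<-⇔<
  (⇔-trans (*-pos-<⇔ 0<M)
  (subst₂-⇔ _<_ (sym (*-assoc M a x)) refl)))
  where
  swap : ∀ a x E → - a * x + E ≡ E - a * x
  swap = solve-∀

dvd-scale : ∀ L d a x E → (+ suc d ∣ a * x + E) ⇔ (+ suc (L ⊗ d) ∣ a * (+ suc L * x) + + suc L * E)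
dvd-scale L d a x E =
  ⇔-trans (*-∣⇔ L) (subst₂-⇔ _∣_ (sym (pos-* (suc L) (suc d))) (distribute (+ suc L) a x E))
  where
  distribute : ∀ L a x E → L * (a * x + E) ≡ a * (L * x) + L * E
  distribute = solve-∀

-- suc (leadMultiple φ) is a common multiple of the leading coefficients of the order atoms of φ.
leadMultiple : QF (suc n) → ℕ
leadMultiple (0< linear _ (+[1+ k ] ∷ _)) = k
leadMultiple (0< linear _ (-[1+ k ] ∷ _)) = k
leadMultiple (φ ∧ ψ)                     = leadMultiple φ ⊗ leadMultiple ψ
leadMultiple (φ ∨ ψ)                     = leadMultiple φ ⊗ leadMultiple ψ
leadMultiple _                           = 0

LeadsDivide : ℕ → QF (suc n) → Set
LeadsDivide L (0< linear _ (+[1+ k ] ∷ _)) = suc k ∣ℕ L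
LeadsDivide L (0< linear _ (-[1+ k ] ∷ _)) = suc k ∣ℕ L
LeadsDivide L (φ ∧ ψ)                     = LeadsDivide L φ × LeadsDivide L ψ
LeadsDivide L (φ ∨ ψ)                     = LeadsDivide L φ × LeadsDivide L ψ
LeadsDivide L _                           = ⊤

LeadsDivide-∣ : ∀ (φ : QF (suc n)) {L L′} → L ∣ℕ L′ → LeadsDivide L φ → LeadsDivide L′ φ
LeadsDivide-∣ (0< linear _ (+ zero ∷ _))   L∣L′ _         = tt
LeadsDivide-∣ (0< linear _ (+[1+ k ] ∷ _)) L∣L′ k∣L       = ℕ∣.∣-trans k∣L L∣L′
LeadsDivide-∣ (0< linear _ (-[1+ k ] ∷ _)) L∣L′ k∣L       = ℕ∣.∣-trans k∣L L∣L′
LeadsDivide-∣ (dvd d l)                    L∣L′ _         = tt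
LeadsDivide-∣ (ndvd d l)                   L∣L′ _         = tt
LeadsDivide-∣ true                         L∣L′ _         = tt
LeadsDivide-∣ false                        L∣L′ _         = tt
LeadsDivide-∣ (φ ∧ ψ)                      L∣L′ (dφ , dψ) = LeadsDivide-∣ φ L∣L′ dφ , LeadsDivide-∣ ψ L∣L′ dψ
LeadsDivide-∣ (φ ∨ ψ)                      L∣L′ (dφ , dψ) = LeadsDivide-∣ φ L∣L′ dφ , LeadsDivide-∣ ψ L∣L′ dψ

LeadsDivide-leadMultiple : ∀ (φ : QF (suc n)) → LeadsDivide (suc (leadMultiple φ)) φ
LeadsDivide-leadMultiple (0< linear _ (+ zero ∷ _))   = tt
LeadsDivide-leadMultiple (0< linear _ (+[1+ k ] ∷ _)) = ℕ∣.∣-refl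
LeadsDivide-leadMultiple (0< linear _ (-[1+ k ] ∷ _)) = ℕ∣.∣-refl
LeadsDivide-leadMultiple (dvd d l)                    = tt
LeadsDivide-leadMultiple (ndvd d l)                   = tt
LeadsDivide-leadMultiple true                         = tt
LeadsDivide-leadMultiple false                        = tt
LeadsDivide-leadMultiple (φ ∧ ψ)                      =
    LeadsDivide-∣ φ (ℕ∣.m∣m*n _) (LeadsDivide-leadMultiple φ)
  , LeadsDivide-∣ ψ (ℕ∣.n∣m*n (suc (leadMultiple φ))) (LeadsDivide-leadMultiple ψ)
LeadsDivide-leadMultiple (φ ∨ ψ)                      =
    LeadsDivide-∣ φ (ℕ∣.m∣m*n _) (LeadsDivide-leadMultiple φ)
  , LeadsDivide-∣ ψ (ℕ∣.n∣m*n (suc (leadMultiple φ))) (LeadsDivide-leadMultiple ψ)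

-- scale L φ describes φ in terms of y = suc L * x.
scale : ℕ → QF (suc n) → Cooper n
scale L (0< linear c (+ zero ∷ as))    = free (0< linear c as)
scale L (0< linear c (+[1+ k ] ∷ as)) = ((- + (suc L / suc k)) ·ₗ linear c as) <y
scale L (0< linear c (-[1+ k ] ∷ as)) = y< (+ (suc L / suc k) ·ₗ linear c as)
scale L (dvd d (linear c (a ∷ as)))    = dvd (L ⊗ d) a (+ suc L ·ₗ linear c as)
scale L (ndvd d (linear c (a ∷ as)))   = ndvd (L ⊗ d) a (+ suc L ·ₗ linear c as)
scale L true                           = free true
scale L false                          = free false
scale L (φ ∧ ψ)                        = scale L φ ∧ scale L ψ
scale L (φ ∨ ψ)                        = scale L φ ∨ scale L ψ

⟦scale⟧ : ∀ L (φ : QF (suc n)) x ρ → LeadsDivide (suc L) φ → ⟦ scale L φ ⟧ᶜ (+ suc L * x) ρ ⇔ ⟦ φ ⟧ (x ∷ₐ ρ)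
⟦scale⟧ L (0< linear c (+ zero ∷ as)) x ρ _ =
  subst-⇔ (0ℤ <_) (trans (sym (0*x+u≡u x _)) (sym (⟦⟧ₗ-∷ₐ c 0ℤ as x ρ)))
⟦scale⟧ L (0< linear c (+[1+ k ] ∷ as)) x ρ k∣L with quotient-pos L k k∣L
... | L≡Mk , 0<M =
  ⇔-trans (subst₂-⇔ _<_ (⟦·ₗ⟧ (- + (suc L / suc k)) (linear c as) ρ) (cong (_* x) L≡Mk))
  (⇔-trans (⇔-sym (lower-scale 0<M (+[1+ k ]) x _))
  (subst-⇔ (0ℤ <_) (sym (⟦⟧ₗ-∷ₐ c +[1+ k ] as x ρ))))
⟦scale⟧ L (0< linear c (-[1+ k ] ∷ as)) x ρ k∣L with quotient-pos L k k∣L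
... | L≡Mk , 0<M =
  ⇔-trans (subst₂-⇔ _<_ (cong (_* x) L≡Mk) (⟦·ₗ⟧ (+ (suc L / suc k)) (linear c as) ρ))
  (⇔-trans (⇔-sym (upper-scale 0<M (+[1+ k ]) x _))
  (subst-⇔ (0ℤ <_) (sym (⟦⟧ₗ-∷ₐ c -[1+ k ] as x ρ))))
⟦scale⟧ L (dvd d (linear c (a ∷ as))) x ρ _ =
  ⇔-trans (subst-⇔ (λ i → + suc (L ⊗ d) ∣ a * (+ suc L * x) + i) (⟦·ₗ⟧ (+ suc L) (linear c as) ρ))
  (⇔-trans (⇔-sym (dvd-scale L d a x _))
  (subst-⇔ (+ suc d ∣_) (sym (⟦⟧ₗ-∷ₐ c a as x ρ))))
⟦scale⟧ L (ndvd d (linear c (a ∷ as))) x ρ _ =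
  ¬-⇔ (⟦scale⟧ L (dvd d (linear c (a ∷ as))) x ρ tt)
⟦scale⟧ L true  x ρ _ = ⇔-refl
⟦scale⟧ L false x ρ _ = ⇔-refl
⟦scale⟧ L (φ ∧ ψ) x ρ (dφ , dψ) = ⟦scale⟧ L φ x ρ dφ ×-⇔ ⟦scale⟧ L ψ x ρ dψ
⟦scale⟧ L (φ ∨ ψ) x ρ (dφ , dψ) = ⟦scale⟧ L φ x ρ dφ ⊎-⇔ ⟦scale⟧ L ψ x ρ dψ

unitScaled : QF (suc n) → Cooper n
unitScaled φ = dvd (leadMultiple φ) 1ℤ (constₗ 0ℤ) ∧ scale (leadMultiple φ) φ

⟦unitScaled⟧ : ∀ (φ : QF (suc n)) ρ → (∃[ x ] ⟦ φ ⟧ (x ∷ₐ ρ)) ⇔ (∃[ y ] ⟦ unitScaled φ ⟧ᶜ y ρ)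
⟦unitScaled⟧ φ ρ = mk⇔
  (λ (x , s) → L′ * x , from (L′∣ (L′ * x)) (∣m⇒∣m*n x ∣-refl) , from (⟦scale⟧ L φ x ρ leads) s)
  (λ { (y , L′∣y , s) → let divides q y≡qL′ = to (L′∣ y) L′∣y in
      q , to (⟦scale⟧ L φ q ρ leads) (subst (λ z → ⟦ scale L φ ⟧ᶜ z ρ) (trans y≡qL′ (*-comm q L′)) s) })
  where
  L = leadMultiple φ
  L′ = + suc L
  leads = LeadsDivide-leadMultiple φ
  1*y+0≡y : ∀ y → 1ℤ * y + 0ℤ ≡ y
  1*y+0≡y = solve-∀
  L′∣ : ∀ y → ⟦ dvd L 1ℤ (constₗ 0ℤ) ⟧ᶜ y ρ ⇔ (L′ ∣ y)
  L′∣ y = subst-⇔ (L′ ∣_) (trans (cong (_+_ (1ℤ * y)) (⟦constₗ⟧ 0ℤ ρ)) (1*y+0≡y y))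

∃-elim : QF (suc n) → QF n
∃-elim φ = cooper (period (unitScaled φ)) (unitScaled φ)

⟦∃-elim⟧ : ∀ (φ : QF (suc n)) ρ → (∃[ x ] ⟦ φ ⟧ (x ∷ₐ ρ)) ⇔ ⟦ ∃-elim φ ⟧ ρ
⟦∃-elim⟧ φ ρ =
  ⇔-trans (⟦unitScaled⟧ φ ρ) (cooper-correct _ (unitScaled φ) ρ (ModuliDivide-period (unitScaled φ)))

-- Quantifier elimination for (ℤ, +, min, max, 0)

qf : Formula n → QF n
qf (s ≐ t)  = atLeaves ⟪ s ⟫ λ l → atLeaves ⟪ t ⟫ λ m → l ≐ₗ m
qf ff       = false
qf tt       = true
qf (¬' φ)   = neg (qf φ)
qf (φ ∧' ψ) = qf φ ∧ qf ψ
qf (φ ∨' ψ) = qf φ ∨ qf ψ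
qf (φ ⇒' ψ) = neg (qf φ) ∨ qf ψ
qf (∀' φ)   = neg (∃-elim (neg (qf φ)))
qf (∃' φ)   = ∃-elim (qf φ)

Sat⇔⟦qf⟧ : ∀ (Φ : Formula n) ρ → Sat Φ ρ ⇔ ⟦ qf Φ ⟧ ρ
Sat⇔⟦qf⟧ (s ≐ t) ρ = ⇔-sym (⟦atLeaves⟧ {p = ⟪ s ⟫} (_≡ eval t ρ)
  (λ l → ⟦atLeaves⟧ {p = ⟪ t ⟫} (⟦ l ⟧ₗ ρ ≡_) (λ m → ⟦≐ₗ⟧ l m ρ) (Evaluates-⟪⟫ t ρ))
  (Evaluates-⟪⟫ s ρ))
Sat⇔⟦qf⟧ ff       ρ = ⇔-refl
Sat⇔⟦qf⟧ tt       ρ = ⇔-refl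
Sat⇔⟦qf⟧ (¬' φ)   ρ = ⇔-trans (¬-⇔ (Sat⇔⟦qf⟧ φ ρ)) (⇔-sym (⟦neg⟧ (qf φ) ρ))
Sat⇔⟦qf⟧ (φ ∧' ψ) ρ = Sat⇔⟦qf⟧ φ ρ ×-⇔ Sat⇔⟦qf⟧ ψ ρ
Sat⇔⟦qf⟧ (φ ∨' ψ) ρ = Sat⇔⟦qf⟧ φ ρ ⊎-⇔ Sat⇔⟦qf⟧ ψ ρ
Sat⇔⟦qf⟧ (φ ⇒' ψ) ρ = ⇔-trans (→-⇔ (Sat⇔⟦qf⟧ φ ρ) (Sat⇔⟦qf⟧ ψ ρ))
  (⇔-sym (⇔-trans (⟦neg⟧ (qf φ) ρ ⊎-⇔ ⇔-refl) (¬⊎⇔→ (⟦⟧-dec (qf φ) ρ))))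
Sat⇔⟦qf⟧ (∀' φ)   ρ = ⇔-trans (Π⇔¬Σ λ a → ⇔-trans (Sat⇔⟦qf⟧ φ (a ∷ₐ ρ)) (⟦⟧⇔¬⟦neg⟧ (qf φ) (a ∷ₐ ρ)))
  (⇔-trans (¬-⇔ (⟦∃-elim⟧ (neg (qf φ)) ρ)) (⇔-sym (⟦neg⟧ (∃-elim (neg (qf φ))) ρ)))
Sat⇔⟦qf⟧ (∃' φ)   ρ = ⇔-trans (Σ-⇔ λ a → Sat⇔⟦qf⟧ φ (a ∷ₐ ρ)) (⟦∃-elim⟧ (qf φ) ρ)

common-support : ∀ {V : Set} (f : Fin n → V → ℤ) → (∀ i → FinSupp (f i)) →
                 Σ (List V) λ S → ∀ v → v ∉ S → ∀ i → f i v ≡ 0ℤ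
common-support f supp = concat (tabulate (proj₁ ∘ supp)) ,
  λ v v∉S i → proj₂ (supp i) v (λ v∈ → v∉S (∈-concat⁺′ v∈ (∈-tabulate⁺ i)))

constantOutside⇒finite⊎cofinite : ∀ {V : Set} → DecidableEquality V → (P : V → Set) (S : List V) →
                  Dec B → (∀ v → v ∉ S → P v ⇔ B) → IsFinite P ⊎ IsCofinite P
constantOutside⇒finite⊎cofinite _≟_ P S (yes b) P⇔B =
  inj₂ (S , λ v ¬Pv → decidable-stable (DecMembership._∈?_ _≟_ v S) (λ v∉S → ¬Pv (from (P⇔B v v∉S) b)))
constantOutside⇒finite⊎cofinite _≟_ P S (no ¬b) P⇔B =
  inj₁ (S , λ v Pv → decidable-stable (DecMembership._∈?_ _≟_ v S) (λ v∉S → ¬b (to (P⇔B v v∉S) Pv)))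

mainTheorem4 : (V : Set) → DecidableEquality V →
               (n : ℕ) (Φ : Formula n) (f : Fin n → V → ℤ) →
               ((i : Fin n) → FinSupp (f i)) →
               IsFinite (λ v → Sat Φ (λ i → f i v)) ⊎ IsCofinite (λ v → Sat Φ (λ i → f i v))
mainTheorem4 V _≟_ n Φ f supp with common-support f supp
... | S , vanish = constantOutside⇒finite⊎cofinite _≟_ _ S (⟦⟧-dec (qf Φ) (λ _ → 0ℤ))
  (λ v v∉S → ⇔-trans (Sat⇔⟦qf⟧ Φ _) (⟦⟧-cong (qf Φ) (vanish v v∉S)))
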